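{- $\mathsf{KDR}\subseteq\mathsf{KD5}\cap\mathsf{F}$. Consequently, $\mathsf{KDR}\subseteq\mathsf{KD5}\cap\mathsf{KD4}\cap\mathsf{KT}$.
   Context: For a modal logic $L$ and formula $A$, $L+A$ denotes the least normal modal logic containing $L$ and $A$. $\mathsf{KD}=\mathsf{K}+\neg\Box\bot$; $\mathsf{KDR}=\mathsf{KD}+\Box\neg p\to\Box\neg\Box p$; $\mathsf{KD5}=\mathsf{KD}+\neg\Box p\to\Box\neg\Box p$; $\mathsf{KD4}=\mathsf{KD}+\Box p\to\Box\Box p$; $\mathsf{KT}=\mathsf{K}+\Box p\to p$; $\mathsf{F}=\mathsf{KD}+\Box p\to\Box((\Box q\to q)\vee\Box p)$. -}

module Defs where

open import Data.Nat using (ℕ)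
open import Data.Bool using (Bool; true; false; not; _∧_; _∨_)
open import Data.Product using (_×_)
open import Data.Sum using (_⊎_)
open import Relation.Binary.PropositionalEquality using (_≡_)

data Fm : Set where
  var : ℕ → Fm
  ⊥'  : Fm
  _⇒_ : Fm → Fm → Fm
  □_  : Fm → Fm

infixr 5 _⇒_
infix 8 □_
infix 8 ¬'_
infixr 6 _∨'_

¬'_ : Fm → Fm
¬' a = a ⇒ ⊥'

_∨'_ : Fm → Fm → Fm
a ∨' b = (¬' a) ⇒ b

p q : Fm
p = var 0
q = var 1

sub : (ℕ → Fm) → Fm → Fm
sub σ (var n) = σ n
sub σ ⊥' = ⊥'
sub σ (a ⇒ b) = sub σ a ⇒ sub σ b
sub σ (□ a) = □ sub σ a

-- Classical propositional tautologies: true under every Boolean valuation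
-- that treats variables and boxed formulas as atoms.
eval : (ℕ → Bool) → (Fm → Bool) → Fm → Bool
eval v w (var n) = v n
eval v w ⊥' = false
eval v w (a ⇒ b) = not (eval v w a) ∨ eval v w b
eval v w (□ a) = w (□ a)

Tautology : Fm → Set
Tautology a = ∀ (v : ℕ → Bool) (w : Fm → Bool) → eval v w a ≡ true

data _⊢_ (Ax : Fm → Set) : Fm → Set where
  taut : ∀ {a} → Tautology a → Ax ⊢ a
  axK  : ∀ {a b} → Ax ⊢ (□ (a ⇒ b) ⇒ □ a ⇒ □ b)
  ax   : ∀ {a} → Ax a → Ax ⊢ a
  mp   : ∀ {a b} → Ax ⊢ (a ⇒ b) → Ax ⊢ a → Ax ⊢ b
  nec  : ∀ {a} → Ax ⊢ a → Ax ⊢ (□ a)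
  us   : ∀ {a} (σ : ℕ → Fm) → Ax ⊢ a → Ax ⊢ sub σ a

infix 3 _⊢_

axD axR ax5 ax4 axT axF : Fm
axD = ¬' □ ⊥'
axR = □ ¬' p ⇒ □ ¬' □ p
ax5 = ¬' □ p ⇒ □ ¬' □ p
ax4 = □ p ⇒ □ □ p
axT = □ p ⇒ p
axF = □ p ⇒ □ ((□ q ⇒ q) ∨' □ p)

KDR-ax KD5-ax KD4-ax KT-ax F-ax : Fm → Set
KDR-ax a = a ≡ axD ⊎ a ≡ axR
KD5-ax a = a ≡ axD ⊎ a ≡ ax5
KD4-ax a = a ≡ axD ⊎ a ≡ ax4
KT-ax  a = a ≡ axT
F-ax   a = a ≡ axD ⊎ a ≡ axF

Logic : Set₁
Logic = Fm → Set

KDR KD5 KD4 KT F : Logic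
KDR a = KDR-ax ⊢ a
KD5 a = KD5-ax ⊢ a
KD4 a = KD4-ax ⊢ a
KT  a = KT-ax ⊢ a
F   a = F-ax ⊢ a

_⊆L_ : Logic → Logic → Set
L ⊆L M = ∀ a → L a → M a

_∩L_ : Logic → Logic → Logic
(L ∩L M) a = L a × M a

infix 4 _⊆L_
infixr 5 _∩L_

-- Containment of normal logics reduces to their axioms: L + Ax ⊆ M as soon
-- as every axiom of Ax is a theorem of M (lemma ⊆-from-axioms), since the
-- remaining rules are shared.
--
-- The theorem then follows from four containments: KDR ⊆ KD5 (R from D and
-- 5), KDR ⊆ F (R from D and an instance of F), F ⊆ KD4 and F ⊆ KT; the
-- last two, composed with KDR ⊆ F, give KDR ⊆ KD4 and KDR ⊆ KT.
module Submission where

open import Defs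
open import Data.Bool using (Bool; true; false; not; _∧_; _∨_; T)
open import Data.Bool.Properties using (T-∧; T-≡)
open import Data.Fin using (Fin; zero; suc)
open import Data.Nat using (ℕ; zero; suc)
open import Data.Product using (_×_; _,_; proj₁; proj₂)
open import Data.Sum using (inj₁; inj₂)
open import Data.Vec using (Vec; []; _∷_; lookup; map)
open import Data.Vec.Properties using (lookup-map)
open import Function using (_∘_)
open import Function.Bundles using (Equivalence)
open import Relation.Binary.PropositionalEquality using (_≡_; refl; sym; trans; cong₂)

open Equivalence using (to)

data Schema (n : ℕ) : Set where
  #_  : Fin n → Schema n
  ⊥ₛ  : Schema n
  _⊃_ : Schema n → Schema n → Schema n

infixr 5 _⊃_
infix 8 ¬ₛ_
infixr 6 _∨ₛ_

¬ₛ_ : ∀ {n} → Schema n → Schema n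
¬ₛ φ = φ ⊃ ⊥ₛ

_∨ₛ_ : ∀ {n} → Schema n → Schema n → Schema n
φ ∨ₛ ψ = (¬ₛ φ) ⊃ ψ

P : ∀ {n} → Schema (suc n)
P = # zero

Q : ∀ {n} → Schema (suc (suc n))
Q = # suc zero

R : ∀ {n} → Schema (suc (suc (suc n)))
R = # suc (suc zero)

S : ∀ {n} → Schema (suc (suc (suc (suc n))))
S = # suc (suc (suc zero))

instantiate : ∀ {n} → Vec Fm n → Schema n → Fm
instantiate ρ (# i) = lookup ρ i
instantiate ρ ⊥ₛ = ⊥'
instantiate ρ (φ ⊃ ψ) = instantiate ρ φ ⇒ instantiate ρ ψ

⟦_⟧ : ∀ {n} → Schema n → Vec Bool n → Bool
⟦ # i ⟧ bs = lookup bs i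
⟦ ⊥ₛ ⟧ bs = false
⟦ φ ⊃ ψ ⟧ bs = not (⟦ φ ⟧ bs) ∨ ⟦ ψ ⟧ bs

eval-instantiate : ∀ {n} v w (ρ : Vec Fm n) (φ : Schema n) →
                   eval v w (instantiate ρ φ) ≡ ⟦ φ ⟧ (map (eval v w) ρ)
eval-instantiate v w ρ (# i) = sym (lookup-map i (eval v w) ρ)
eval-instantiate v w ρ ⊥ₛ = refl
eval-instantiate v w ρ (φ ⊃ ψ) =
  cong₂ (λ x y → not x ∨ y) (eval-instantiate v w ρ φ) (eval-instantiate v w ρ ψ)

all-inputs : ∀ n → (Vec Bool n → Bool) → Bool
all-inputs zero f = f []
all-inputs (suc n) f = all-inputs n (f ∘ (true ∷_)) ∧ all-inputs n (f ∘ (false ∷_))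

all-inputs-sound : ∀ n (f : Vec Bool n → Bool) → T (all-inputs n f) → ∀ bs → T (f bs)
all-inputs-sound zero f holds [] = holds
all-inputs-sound (suc n) f holds (true ∷ bs) =
  all-inputs-sound n _ (proj₁ (to T-∧ holds)) bs
all-inputs-sound (suc n) f holds (false ∷ bs) =
  all-inputs-sound n _ (proj₂ (to T-∧ holds)) bs

valid : ∀ {n} → Schema n → Bool
valid {n} φ = all-inputs n ⟦ φ ⟧

instance-is-tautology : ∀ {n} (φ : Schema n) → T (valid φ) →
                        (ρ : Vec Fm n) → Tautology (instantiate ρ φ)
instance-is-tautology {n} φ φ-valid ρ v w =
  trans (eval-instantiate v w ρ φ)
        (to T-≡ (all-inputs-sound n ⟦ φ ⟧ φ-valid (map (eval v w) ρ)))

⊆-from-axioms : ∀ {Ax Ax' : Fm → Set} →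
                (∀ a → Ax a → Ax' ⊢ a) → (Ax ⊢_) ⊆L (Ax' ⊢_)
⊆-from-axioms axioms _ (taut t) = taut t
⊆-from-axioms axioms _ axK = axK
⊆-from-axioms axioms _ (ax {a} a∈Ax) = axioms a a∈Ax
⊆-from-axioms axioms _ (mp d e) = mp (⊆-from-axioms axioms _ d) (⊆-from-axioms axioms _ e)
⊆-from-axioms axioms _ (nec d) = nec (⊆-from-axioms axioms _ d)
⊆-from-axioms axioms _ (us σ d) = us σ (⊆-from-axioms axioms _ d)

⊆L-trans : ∀ {L M N : Logic} → L ⊆L M → M ⊆L N → L ⊆L N
⊆L-trans L⊆M M⊆N a = M⊆N a ∘ L⊆M a

module _ {Ax : Fm → Set} where

  -- Instances of valid schemata are theorems (validity is checked by computation).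
  tautology : ∀ {n} (φ : Schema n) {φ-valid : T (valid φ)} (ρ : Vec Fm n) →
              Ax ⊢ instantiate ρ φ
  tautology φ {φ-valid} ρ = taut (instance-is-tautology φ φ-valid ρ)

  ∨-introˡ : ∀ {a b} → Ax ⊢ a ⇒ a ∨' b
  ∨-introˡ {a} {b} = tautology (P ⊃ P ∨ₛ Q) (a ∷ b ∷ [])

  ∨-introʳ : ∀ {a b} → Ax ⊢ b ⇒ a ∨' b
  ∨-introʳ {a} {b} = tautology (Q ⊃ P ∨ₛ Q) (a ∷ b ∷ [])

  weaken : ∀ {a b} → Ax ⊢ b → Ax ⊢ a ⇒ b
  weaken {a} {b} ⊢b = mp (tautology (P ⊃ Q ⊃ P) (b ∷ a ∷ [])) ⊢b

  ⇒-trans : ∀ {a b c} → Ax ⊢ a ⇒ b → Ax ⊢ b ⇒ c → Ax ⊢ a ⇒ c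
  ⇒-trans {a} {b} {c} =
    mp ∘ mp (tautology ((P ⊃ Q) ⊃ (Q ⊃ R) ⊃ P ⊃ R) (a ∷ b ∷ c ∷ []))

  ⇒-trans₂ : ∀ {a b c d} → Ax ⊢ a ⇒ b ⇒ c → Ax ⊢ c ⇒ d → Ax ⊢ a ⇒ b ⇒ d
  ⇒-trans₂ {a} {b} {c} {d} =
    mp ∘ mp (tautology ((P ⊃ Q ⊃ R) ⊃ (R ⊃ S) ⊃ P ⊃ Q ⊃ S) (a ∷ b ∷ c ∷ d ∷ []))

  discharge : ∀ {a b c} → Ax ⊢ a ⇒ b ⇒ c → Ax ⊢ b → Ax ⊢ a ⇒ c
  discharge {a} {b} {c} =
    mp ∘ mp (tautology ((P ⊃ Q ⊃ R) ⊃ Q ⊃ P ⊃ R) (a ∷ b ∷ c ∷ []))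

  ⇒-contract : ∀ {a b c} → Ax ⊢ a ⇒ b → Ax ⊢ b ⇒ a ⇒ c → Ax ⊢ a ⇒ c
  ⇒-contract {a} {b} {c} =
    mp ∘ mp (tautology ((P ⊃ Q) ⊃ (Q ⊃ P ⊃ R) ⊃ P ⊃ R) (a ∷ b ∷ c ∷ []))

  □-mono : ∀ {a b} → Ax ⊢ a ⇒ b → Ax ⊢ □ a ⇒ □ b
  □-mono = mp axK ∘ nec

  □-mono₂ : ∀ {a b c} → Ax ⊢ a ⇒ b ⇒ c → Ax ⊢ □ a ⇒ □ b ⇒ □ c
  □-mono₂ ⊢a⇒b⇒c = ⇒-trans (□-mono ⊢a⇒b⇒c) axK

  -- Under the axiom D, a formula whose negation is necessary is not necessary:
  -- □¬a and □a give □⊥ by K, which D refutes.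
  D-□¬⇒¬□ : ∀ {a} → Ax ⊢ axD → Ax ⊢ □ ¬' a ⇒ ¬' □ a
  D-□¬⇒¬□ {a} ⊢D = ⇒-trans₂ (□-mono₂ (tautology (¬ₛ P ⊃ P ⊃ ⊥ₛ) (a ∷ []))) ⊢D

[p≔_,q≔_] : Fm → Fm → ℕ → Fm
[p≔ a ,q≔ b ] zero = a
[p≔ a ,q≔ b ] (suc zero) = b
[p≔ a ,q≔ b ] (suc (suc n)) = var (suc (suc n))

-- R is the D-consequence □¬p → ¬□p followed by 5.
KDR⊆KD5 : KDR ⊆L KD5
KDR⊆KD5 = ⊆-from-axioms λ where
  _ (inj₁ refl) → ax (inj₁ refl)
  _ (inj₂ refl) → ⇒-trans (D-□¬⇒¬□ (ax (inj₁ refl))) (ax (inj₂ refl))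

-- The instance □¬p → □((□p → p) ∨ □¬p) of F yields R: under the box,
-- □¬p → ¬□p (from D) turns the disjunction into ¬p → ¬□p.
R-in-F : F-ax ⊢ axR
R-in-F = ⇒-contract F-instance (□-mono₂ disjunction⇒R-body)
  where
  F-instance : F-ax ⊢ □ ¬' p ⇒ □ ((□ p ⇒ p) ∨' □ ¬' p)
  F-instance = us [p≔ ¬' p ,q≔ p ] (ax (inj₂ refl))

  disjunction⇒R-body : F-ax ⊢ ((□ p ⇒ p) ∨' □ ¬' p) ⇒ ¬' p ⇒ ¬' □ p
  disjunction⇒R-body =
    discharge (tautology (((P ⊃ Q) ∨ₛ R) ⊃ (R ⊃ ¬ₛ P) ⊃ ¬ₛ Q ⊃ ¬ₛ P)
                         (□ p ∷ p ∷ □ ¬' p ∷ []))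
              (D-□¬⇒¬□ (ax (inj₁ refl)))

KDR⊆F : KDR ⊆L F
KDR⊆F = ⊆-from-axioms λ where
  _ (inj₁ refl) → ax (inj₁ refl)
  _ (inj₂ refl) → R-in-F

-- F follows from 4, since □□p → □(x ∨ □p).
F⊆KD4 : F ⊆L KD4
F⊆KD4 = ⊆-from-axioms λ where
  _ (inj₁ refl) → ax (inj₁ refl)
  _ (inj₂ refl) → ⇒-trans (ax (inj₂ refl)) (□-mono ∨-introʳ)

-- In KT, D is the instance □⊥ → ⊥ of T, and F holds because its
-- consequent □((□q → q) ∨ □p) is necessitated from T.
F⊆KT : F ⊆L KT
F⊆KT = ⊆-from-axioms λ where
  _ (inj₁ refl) → us [p≔ ⊥' ,q≔ q ] (ax refl)
  _ (inj₂ refl) → weaken (nec (mp ∨-introˡ (us [p≔ q ,q≔ q ] (ax refl))))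

proposition4p12 : (KDR ⊆L KD5 ∩L F) × (KDR ⊆L KD5 ∩L KD4 ∩L KT)
proposition4p12 =
    (λ a ⊢a → KDR⊆KD5 a ⊢a , KDR⊆F a ⊢a)
  , (λ a ⊢a → KDR⊆KD5 a ⊢a , KDR⊆KD4 a ⊢a , KDR⊆KT a ⊢a)
  where
  KDR⊆KD4 : KDR ⊆L KD4
  KDR⊆KD4 = ⊆L-trans KDR⊆F F⊆KD4

  KDR⊆KT : KDR ⊆L KT
  KDR⊆KT = ⊆L-trans KDR⊆F F⊆KT
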